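{- For every $n\ge 1$, $$\sum_{\sigma\in B_n} (-1)^{\mathrm{neg}(\sigma)} q^{\mathrm{fmaj}(\sigma)} = [2]_{ -q}[4]_{ -q}\cdots[2n]_{ -q}.$$
   Context: $B_n$ is the group of signed permutations of $[n]$. $[n]_q=(1-q^n)/(1-q)$. $\mathrm{neg}(\sigma)=\#\{i:\sigma(i)<0\}$; $\mathrm{fmaj}(\sigma)=2\,\mathrm{maj}(\sigma)+\mathrm{neg}(\sigma)$ with $\mathrm{maj}$ the major index of $(\sigma(1),\dots,\sigma(n))$ with respect to the order $-1<\cdots<-n<1<\cdots<n$. -}

module Defs where

open import Data.Bool using (Bool; true; false; if_then_else_)
open import Data.Nat as ℕ using (ℕ; zero; suc; _<ᵇ_)
open import Data.Fin as Fin using (Fin; toℕ)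
open import Data.Fin.Properties using () renaming (_≟_ to _≟ᶠ_)
open import Data.Integer as ℤ using (ℤ; +_; -_)
open import Data.List as List using (List; []; _∷_; map; filter; allFin; cartesianProduct; concatMap; replicate; _++_; length)
open import Data.Product using (_×_; _,_; proj₁; proj₂)
open import Data.Vec as Vec using (Vec; []; _∷_; toList)

-- Polynomials in q with integer coefficients, as coefficient lists
-- (constant term first).  Equality of polynomials is equality of all
-- coefficients (see `coeff`), so trailing zeros are irrelevant.

Poly : Set
Poly = List ℤ

coeff : Poly → ℕ → ℤ
coeff []       _       = + 0
coeff (c ∷ p)  zero    = c
coeff (c ∷ p)  (suc k) = coeff p k

_⊕_ : Poly → Poly → Poly
[]      ⊕ q       = q
(a ∷ p) ⊕ []      = a ∷ p
(a ∷ p) ⊕ (b ∷ q) = (a ℤ.+ b) ∷ (p ⊕ q)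

scale : ℤ → Poly → Poly
scale c = map (c ℤ.*_)

_⊗_ : Poly → Poly → Poly
[]      ⊗ q = []
(a ∷ p) ⊗ q = scale a q ⊕ (+ 0 ∷ (p ⊗ q))

monomial : ℤ → ℕ → Poly
monomial c k = replicate k (+ 0) ++ (c ∷ [])

sumPoly : List Poly → Poly
sumPoly = List.foldr _⊕_ []

prodPoly : List Poly → Poly
prodPoly = List.foldr _⊗_ (+ 1 ∷ [])

signPow : ℕ → ℤ
signPow zero    = + 1
signPow (suc k) = - signPow k

qIntNeg : ℕ → Poly
qIntNeg m = List.map signPow (List.upTo m)

rhs : ℕ → Poly
rhs n = prodPoly (List.map (λ i → qIntNeg (2 ℕ.* suc i)) (List.upTo n))

-- A letter (b , a) with b : Bool, a : Fin n stands for the integer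
-- -(a+1) if b = true and +(a+1) if b = false.
-- A signed permutation σ ∈ B_n is the word (σ(1),…,σ(n)) of such
-- letters whose absolute values a are pairwise distinct.

Letter : ℕ → Set
Letter n = Bool × Fin n

words : {A : Set} → List A → (k : ℕ) → List (Vec A k)
words xs zero    = [] ∷ []
words xs (suc k) = concatMap (λ x → map (x ∷_) (words xs k)) xs

absVals : ∀ {n k} → Vec (Letter n) k → List (Fin n)
absVals w = map proj₂ (toList w)

import Data.List.Relation.Unary.Unique.DecPropositional as UniqueDec

module UF (n : ℕ) = UniqueDec (_≟ᶠ_ {n})

Bn : (n : ℕ) → List (Vec (Letter n) n)
Bn n = filter (λ (w : Vec (Letter n) n) → UF.unique? n (absVals {n} w))
              (words (cartesianProduct (true ∷ false ∷ []) (allFin n)) n)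

-- position in the order -1 < -2 < ... < -n < 1 < 2 < ... < n
key : ∀ {n} → Letter n → ℕ
key {n} (true  , a) = toℕ a
key {n} (false , a) = n ℕ.+ toℕ a

neg : ∀ {n k} → Vec (Letter n) k → ℕ
neg []               = 0
neg ((true  , _) ∷ w) = suc (neg w)
neg ((false , _) ∷ w) = neg w

majFrom : ∀ {n k} → ℕ → Vec (Letter n) k → ℕ
majFrom i []            = 0
majFrom i (x ∷ [])      = 0
majFrom i (x ∷ y ∷ w)   =
  (if key y <ᵇ key x then i else 0) ℕ.+ majFrom (suc i) (y ∷ w)

maj : ∀ {n k} → Vec (Letter n) k → ℕ
maj = majFrom 1

fmaj : ∀ {n k} → Vec (Letter n) k → ℕ
fmaj σ = 2 ℕ.* maj σ ℕ.+ neg σ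

lhs : ℕ → Poly
lhs n = sumPoly (map (λ σ → monomial (signPow (neg σ)) (fmaj σ)) (Bn n))

module Submission where

-- Since fmaj σ = 2 maj σ + neg σ, the sign (-1)^{neg σ} is (-1)^{fmaj σ}, so the left side is
-- Σ_σ (-q)^{fmaj σ}. Both sides are thus generating polynomials Σ_{e ∈ E} q^e of multisets E,
-- evaluated at -q, and it suffices that the multiset {fmaj σ : σ ∈ B_n} is the sumset
-- {0,…,1} + {0,…,3} + ⋯ + {0,…,2n-1} of the exponents of [2]_q [4]_q ⋯ [2n]_q.
--
-- For that we track the last letter. Over an alphabet X of 2(m+1) signed letters, the pairs
-- (fmaj w, last letter of w) for the injective words w of length m+1 are, as a multiset, the
-- pairs (rank z + t, z), where the rank of z counts the letters of X larger than z and t runs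
-- over the sumset for [2]_q ⋯ [2m]_q. Indeed, appending z to an injective word u of length m
-- ending in y adds 2m·[z < y] + [z < 0] to fmaj. Over the 2m letters X′ left for u, adding
-- 2m·[z < y] to the rank of y rotates the ranks {0,…,2m-1} onto the interval starting at the
-- rank of z in X′, and adding [z < 0] turns that into the rank of z in X. Finally the ranks of
-- all letters of X form {0,…,2n-1}.

open import Defs
open import Data.Nat using (ℕ; _≥_)
open import Relation.Binary.PropositionalEquality using (_≡_)

open import Data.Bool using (Bool; true; false; if_then_else_)
open import Data.Fin using (Fin; toℕ)
import Data.Fin.Properties as Fin
import Data.Integer
module ℤ = Data.Integer hiding (+_)
open Data.Integer using (ℤ; -_) renaming (+_ to pos)
import Data.Integer.Properties as ℤₚ
open import Data.Integer.Tactic.RingSolver using (solve-∀)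
open import Data.List as List
  using (List; []; _∷_; _++_; [_]; map; concatMap; filter; length; upTo; foldr)
import Data.List.Properties as List
open import Data.List.Membership.Propositional using (_∈_)
open import Data.List.Membership.Propositional.Properties using (∈-filter⁻)
import Data.List.Relation.Binary.Permutation.Propositional as ↭
open ↭ using (_↭_; ↭-refl; ↭-prep; ↭-trans; ↭-sym; ↭-reflexive; module PermutationReasoning)
open import Data.List.Relation.Binary.Permutation.Propositional.Properties
  using (map⁺; ++⁺; ++⁺ˡ; ++-comm; shift; shifts; ↭-length; filter-↭; All-resp-↭; ↭-reverse)
open import Data.List.Relation.Binary.Sublist.Propositional using (⊆-refl)
import Data.List.Relation.Binary.Sublist.Propositional.Properties as Sublist
open import Data.List.Relation.Unary.All as All using (All; []; _∷_; all?)
import Data.List.Relation.Unary.All.Properties as Allₚ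
open import Data.List.Relation.Unary.AllPairs using (AllPairs; []; _∷_)
import Data.List.Relation.Unary.AllPairs.Properties as AllPairs
open import Data.List.Relation.Unary.Any using (here; there)
open import Data.List.Relation.Unary.Unique.Propositional using (Unique)
import Data.List.Relation.Unary.Unique.Propositional.Properties as Uniqueₚ
open import Data.Nat as ℕ using (zero; suc; _+_; _*_; _≤_; _<_; _≟_; _<?_; _<ᵇ_; s≤s)
import Data.Nat.Properties as ℕ
open import Algebra.Properties.CommutativeSemigroup ℕ.+-commutativeSemigroup
  using () renaming (xy∙z≈xz∙y to +-right-comm)
import Data.Nat.Tactic.RingSolver as ℕ-Solver
open import Data.Product using (_×_; _,_; proj₁; proj₂; ∃)
open import Data.Vec as Vec using (Vec; _∷ʳ_)
import Data.Vec.Properties as Vecₚ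
open import Function using (_∘_; id)
open import Level using (Level)
open import Relation.Binary.Definitions using (tri<; tri≈; tri>)
open import Relation.Binary.PropositionalEquality
  using (refl; sym; trans; cong; cong₂; subst; _≗_; _≢_; module ≡-Reasoning)
open import Relation.Nullary using (does; yes; no; ¬_; ¬?; contradiction)
open import Relation.Nullary.Decidable using (dec-true; dec-false)
open import Relation.Unary using (Pred; Decidable; _⊆_; _≐_)
open import Relation.Unary.Properties using (∁?; _∩?_)

private
  variable
    A B C E : Set

module _ {p} {P : Pred B p} (P? : Decidable P) where

  filter-map : (f : A → B) (xs : List A) → filter P? (map f xs) ≡ map f (filter (P? ∘ f) xs)
  filter-map f []       = refl
  filter-map f (x ∷ xs) with does (P? (f x))
  ... | true  = cong (f x ∷_) (filter-map f xs)
  ... | false = filter-map f xs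

  filter-concatMap : (f : A → List B) (xs : List A) →
                     filter P? (concatMap f xs) ≡ concatMap (filter P? ∘ f) xs
  filter-concatMap f []       = refl
  filter-concatMap f (x ∷ xs) =
    trans (List.filter-++ P? (f x) _) (cong (filter P? (f x) ++_) (filter-concatMap f xs))

module _ {p} {P : Pred A p} (P? : Decidable P) where

  concatMap-filter : (f : A → List B) (xs : List A) →
                     concatMap f (filter P? xs) ≡ concatMap (λ x → if does (P? x) then f x else []) xs
  concatMap-filter f []       = refl
  concatMap-filter f (x ∷ xs) with does (P? x)
  ... | true  = cong (f x ++_) (concatMap-filter f xs)
  ... | false = concatMap-filter f xs

  ↭-filter-∁ : (xs : List A) → xs ↭ filter P? xs ++ filter (∁? P?) xs
  ↭-filter-∁ []       = ↭-refl
  ↭-filter-∁ (x ∷ xs) with P? x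
  ... | yes _ = ↭-prep x (↭-filter-∁ xs)
  ... | no  _ = ↭-trans (↭-prep x (↭-filter-∁ xs)) (↭-sym (shift x (filter P? xs) _))

module _ {p q} {P : Pred A p} {Q : Pred A q} (P? : Decidable P) (Q? : Decidable Q) where

  filter-∩ : (xs : List A) → filter (P? ∩? Q?) xs ≡ filter Q? (filter P? xs)
  filter-∩ []       = refl
  filter-∩ (x ∷ xs) with P? x
  ... | no  _ = filter-∩ xs
  ... | yes _ with Q? x
  ...   | yes _ = cong (x ∷_) (filter-∩ xs)
  ...   | no  _ = filter-∩ xs

  module _ (P⊆Q : P ⊆ Q) where

    length-filter-⊆ : (xs : List A) → length (filter P? xs) ≤ length (filter Q? xs)
    length-filter-⊆ xs = Sublist.length-mono-≤ (Sublist.filter⁺ P? Q? (λ { refl → P⊆Q }) (⊆-refl {x = xs}))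

    length-filter-⊂ : {y : A} {xs : List A} → y ∈ xs → Q y → ¬ P y →
                      length (filter P? xs) < length (filter Q? xs)
    length-filter-⊂ {y} {_ ∷ xs} (here refl) qy ¬py
      rewrite List.filter-accept Q? {xs = xs} qy | List.filter-reject P? {xs = xs} ¬py =
      s≤s (length-filter-⊆ xs)
    length-filter-⊂ {y} {x ∷ xs} (there y∈xs) qy ¬py with P? x | Q? x
    ... | yes _  | yes _  = s≤s (length-filter-⊂ y∈xs qy ¬py)
    ... | yes px | no ¬qx = contradiction (P⊆Q px) ¬qx
    ... | no _   | yes _  = ℕ.m≤n⇒m≤1+n (length-filter-⊂ y∈xs qy ¬py)
    ... | no _   | no _   = length-filter-⊂ y∈xs qy ¬py

Unique-∷ʳ⁺ : {xs : List A} {a : A} → Unique xs → All (a ≢_) xs → Unique (xs ++ [ a ])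
Unique-∷ʳ⁺ []        []           = [] ∷ []
Unique-∷ʳ⁺ (x∉xs ∷ u) (a≢x ∷ a∉xs) = Allₚ.++⁺ x∉xs ((a≢x ∘ sym) ∷ []) ∷ Unique-∷ʳ⁺ u a∉xs

Unique-∷ʳ⁻ : (xs : List A) {a : A} → Unique (xs ++ [ a ]) → Unique xs × All (a ≢_) xs
Unique-∷ʳ⁻ []       _          = [] , []
Unique-∷ʳ⁻ (x ∷ xs) (x∉xsa ∷ u) with Unique-∷ʳ⁻ xs u | Allₚ.++⁻ʳ xs x∉xsa
... | u′ , a∉xs | x≢a ∷ [] = (Allₚ.++⁻ˡ xs x∉xsa ∷ u′) , (x≢a ∘ sym) ∷ a∉xs

Unique-remove : {as : List A} {a : A} → Unique as → a ∈ as →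
                ∃ λ as′ → (as ↭ a ∷ as′) × Unique as′ × All (a ≢_) as′
Unique-remove {as = a ∷ as′} (a∉as′ ∷ u) (here refl) = as′ , ↭-refl , u , a∉as′
Unique-remove {as = x ∷ xs} {a} (x∉xs ∷ u) (there a∈xs) with Unique-remove u a∈xs
... | xs′ , xs↭ , u′ , a∉xs′ with All-resp-↭ xs↭ x∉xs
...   | x≢a ∷ x∉xs′ =
  x ∷ xs′ , ↭-trans (↭-prep x xs↭) (↭.swap x a ↭-refl) , x∉xs′ ∷ u′ , (x≢a ∘ sym) ∷ a∉xs′

map-concatMap-map : (f : C → E) (g : A → B → C) (xs : List A) (ys : List B) →
                    map f (concatMap (λ x → map (g x) ys) xs) ≡ concatMap (λ x → map (f ∘ g x) ys) xs
map-concatMap-map f g xs ys =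
  trans (List.map-concatMap f _ xs) (List.concatMap-cong (λ x → sym (List.map-∘ ys)) xs)

concatMap-↭ : (f : A → List B) {xs ys : List A} → xs ↭ ys → concatMap f xs ↭ concatMap f ys
concatMap-↭ f ↭.refl         = ↭-refl
concatMap-↭ f (↭.prep x p)   = ++⁺ˡ (f x) (concatMap-↭ f p)
concatMap-↭ f {x ∷ y ∷ xs} {_ ∷ _ ∷ ys} (↭.swap x y p) = begin
  f x ++ f y ++ concatMap f xs ↭⟨ shifts (f x) (f y) ⟩
  f y ++ f x ++ concatMap f xs ↭⟨ ++⁺ˡ (f y) (++⁺ˡ (f x) (concatMap-↭ f p)) ⟩
  f y ++ f x ++ concatMap f ys ∎
  where open PermutationReasoning
concatMap-↭ f (↭.trans p q) = ↭-trans (concatMap-↭ f p) (concatMap-↭ f q)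

concatMap-cong-↭ : {f g : A → List B} (xs : List A) → (∀ {x} → x ∈ xs → f x ↭ g x) →
                   concatMap f xs ↭ concatMap g xs
concatMap-cong-↭ []       h = ↭-refl
concatMap-cong-↭ (x ∷ xs) h = ++⁺ (h (here refl)) (concatMap-cong-↭ xs (h ∘ there))

concatMap-++-↭ : (f g : A → List B) (xs : List A) →
                 concatMap (λ x → f x ++ g x) xs ↭ concatMap f xs ++ concatMap g xs
concatMap-++-↭ f g []       = ↭-refl
concatMap-++-↭ f g (x ∷ xs) = begin
  (f x ++ g x) ++ concatMap (λ x → f x ++ g x) xs  ≡⟨ List.++-assoc (f x) (g x) _ ⟩
  f x ++ g x ++ concatMap (λ x → f x ++ g x) xs    ↭⟨ ++⁺ˡ (f x) (++⁺ˡ (g x) (concatMap-++-↭ f g xs)) ⟩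
  f x ++ g x ++ concatMap f xs ++ concatMap g xs   ↭⟨ ++⁺ˡ (f x) (shifts (g x) (concatMap f xs)) ⟩
  f x ++ concatMap f xs ++ g x ++ concatMap g xs   ≡⟨ List.++-assoc (f x) (concatMap f xs) _ ⟨
  (f x ++ concatMap f xs) ++ g x ++ concatMap g xs ∎
  where open PermutationReasoning

concatMap-comm : (h : A → B → List C) (xs : List A) (ys : List B) →
                 concatMap (λ x → concatMap (h x) ys) xs ↭ concatMap (λ y → concatMap (λ x → h x y) xs) ys
concatMap-comm h []       ys = ↭-reflexive (sym (concatMap-[] ys))
  where
  concatMap-[] : (ys : List B) → concatMap {B = C} (λ _ → []) ys ≡ []
  concatMap-[] []       = refl
  concatMap-[] (_ ∷ ys) = concatMap-[] ys
concatMap-comm h (x ∷ xs) ys = ↭-trans (++⁺ˡ (concatMap (h x) ys) (concatMap-comm h xs ys))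
  (↭-sym (concatMap-++-↭ (h x) (λ y → concatMap (λ x → h x y) xs) ys))

upTo-suc : (m : ℕ) → upTo (suc m) ≡ 0 ∷ map suc (upTo m)
upTo-suc m = cong (0 ∷_) (sym (List.map-upTo suc m))

upTo-+ : (m n : ℕ) → upTo (m + n) ≡ upTo m ++ map (m +_) (upTo n)
upTo-+ zero    n = sym (List.map-id (upTo n))
upTo-+ (suc m) n = begin
  upTo (suc (m + n))                                    ≡⟨ upTo-suc (m + n) ⟩
  0 ∷ map suc (upTo (m + n))                            ≡⟨ cong (λ U → 0 ∷ map suc U) (upTo-+ m n) ⟩
  0 ∷ map suc (upTo m ++ map (m +_) (upTo n))           ≡⟨ cong (0 ∷_) (List.map-++ suc (upTo m) _) ⟩
  0 ∷ map suc (upTo m) ++ map suc (map (m +_) (upTo n)) ≡⟨ cong (λ U → 0 ∷ map suc (upTo m) ++ U) (List.map-∘ (upTo n)) ⟨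
  0 ∷ map suc (upTo m) ++ map (suc m +_) (upTo n)       ≡⟨ cong (_++ map (suc m +_) (upTo n)) (upTo-suc m) ⟨
  upTo (suc m) ++ map (suc m +_) (upTo n)               ∎
  where open ≡-Reasoning

map-+-upTo-+ : (u δ : ℕ) → map (u +_) (upTo (u + δ)) ≡ map (u +_) (upTo δ) ++ map ((u + δ) +_) (upTo u)
map-+-upTo-+ u δ = begin
  map (u +_) (upTo (u + δ))                               ≡⟨ cong (λ n → map (u +_) (upTo n)) (ℕ.+-comm u δ) ⟩
  map (u +_) (upTo (δ + u))                               ≡⟨ cong (map (u +_)) (upTo-+ δ u) ⟩
  map (u +_) (upTo δ ++ map (δ +_) (upTo u))              ≡⟨ List.map-++ (u +_) (upTo δ) _ ⟩
  map (u +_) (upTo δ) ++ map (u +_) (map (δ +_) (upTo u)) ≡⟨ cong (map (u +_) (upTo δ) ++_) (List.map-∘ (upTo u)) ⟨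
  map (u +_) (upTo δ) ++ map (λ i → u + (δ + i)) (upTo u)
    ≡⟨ cong (map (u +_) (upTo δ) ++_) (List.map-cong (λ i → sym (ℕ.+-assoc u δ i)) (upTo u)) ⟩
  map (u +_) (upTo δ) ++ map ((u + δ) +_) (upTo u)        ∎
  where open ≡-Reasoning

-- Multisets of natural numbers

infixr 6 _⊞_

_⊞_ : List ℕ → List ℕ → List ℕ
E ⊞ F = concatMap (λ e → map (e +_) F) E

⊞-congˡ : {E E′ : List ℕ} (F : List ℕ) → E ↭ E′ → E ⊞ F ↭ E′ ⊞ F
⊞-congˡ F = concatMap-↭ (λ e → map (e +_) F)

⊞-congʳ : (E : List ℕ) {F F′ : List ℕ} → F ↭ F′ → E ⊞ F ↭ E ⊞ F′
⊞-congʳ E p = concatMap-cong-↭ E (λ _ → map⁺ _ p)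

map-+-⊞ : (a : ℕ) (E F : List ℕ) → map (a +_) (E ⊞ F) ≡ map (a +_) E ⊞ F
map-+-⊞ a E F = begin
  map (a +_) (concatMap (λ e → map (e +_) F) E)  ≡⟨ List.map-concatMap (a +_) _ E ⟩
  concatMap (λ e → map (a +_) (map (e +_) F)) E ≡⟨ List.concatMap-cong shift-shift E ⟩
  concatMap (λ e → map ((a + e) +_) F) E        ≡⟨ List.concatMap-map (λ e → map (e +_) F) (a +_) E ⟨
  map (a +_) E ⊞ F                              ∎
  where
  open ≡-Reasoning
  shift-shift : ∀ e → map (a +_) (map (e +_) F) ≡ map ((a + e) +_) F
  shift-shift e = trans (sym (List.map-∘ F)) (List.map-cong (λ f → sym (ℕ.+-assoc a e f)) F)

map-tag-⊞ : (r : ℕ) (z : A) (U T : List ℕ) → map (_, z) (map (r +_) U ⊞ T) ≡ map (λ t → r + t , z) (U ⊞ T)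
map-tag-⊞ r z U T = trans (cong (map (_, z)) (sym (map-+-⊞ r U T))) (sym (List.map-∘ (U ⊞ T)))

⊞-⊞-concatMap : (E₁ E₂ F : List ℕ) →
                E₁ ⊞ (E₂ ⊞ F) ≡ concatMap (λ a → concatMap (λ b → map ((a + b) +_) F) E₂) E₁
⊞-⊞-concatMap E₁ E₂ F = List.concatMap-cong
  (λ a → trans (map-+-⊞ a E₂ F) (List.concatMap-map (λ e → map (e +_) F) (a +_) E₂)) E₁

⊞-leftComm : (E₁ E₂ F : List ℕ) → E₁ ⊞ (E₂ ⊞ F) ↭ E₂ ⊞ (E₁ ⊞ F)
⊞-leftComm E₁ E₂ F = begin
  E₁ ⊞ (E₂ ⊞ F)                                                 ≡⟨ ⊞-⊞-concatMap E₁ E₂ F ⟩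
  concatMap (λ a → concatMap (λ b → map ((a + b) +_) F) E₂) E₁  ↭⟨ concatMap-comm _ E₁ E₂ ⟩
  concatMap (λ b → concatMap (λ a → map ((a + b) +_) F) E₁) E₂
    ≡⟨ List.concatMap-cong (λ b → List.concatMap-cong (λ a → cong (λ c → map (c +_) F) (ℕ.+-comm a b)) E₁) E₂ ⟩
  concatMap (λ b → concatMap (λ a → map ((b + a) +_) F) E₁) E₂  ≡⟨ ⊞-⊞-concatMap E₂ E₁ F ⟨
  E₂ ⊞ (E₁ ⊞ F)                                                 ∎
  where open PermutationReasoning

-- The exponents of [s₁]_q [s₂]_q ⋯ [s_r]_q, with multiplicity.
sumset : List ℕ → List ℕ
sumset = foldr (λ s T → upTo s ⊞ T) (0 ∷ [])

sumset-↭ : {ss ss′ : List ℕ} → ss ↭ ss′ → sumset ss ↭ sumset ss′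
sumset-↭ ↭.refl         = ↭-refl
sumset-↭ (↭.prep s p)   = ⊞-congʳ (upTo s) (sumset-↭ p)
sumset-↭ {s ∷ t ∷ ss} (↭.swap s t p) =
  ↭-trans (⊞-leftComm (upTo s) (upTo t) (sumset ss)) (⊞-congʳ (upTo t) (⊞-congʳ (upTo s) (sumset-↭ p)))
sumset-↭ (↭.trans p q) = ↭-trans (sumset-↭ p) (sumset-↭ q)

-- Listed from the largest factor down, so that evenSumset (suc j) unfolds to upTo (2 * suc j) ⊞ evenSumset j.
evenSumset : ℕ → List ℕ
evenSumset n = sumset (map (λ i → 2 * suc i) (List.downFrom n))

evenSumset-↭ : (n : ℕ) → evenSumset n ↭ sumset (map (λ i → 2 * suc i) (upTo n))
evenSumset-↭ n = sumset-↭ (map⁺ _ (↭-trans (↭-reflexive (sym (List.reverse-upTo n))) (↭-reverse (upTo n))))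

-- Convolution and generating polynomials

conv : (ℕ → ℤ) → (ℕ → ℤ) → ℕ → ℤ
conv f g zero    = f 0 ℤ.* g 0
conv f g (suc k) = f 0 ℤ.* g (suc k) ℤ.+ conv (f ∘ suc) g k

conv-cong : {f f′ g g′ : ℕ → ℤ} → f ≗ f′ → g ≗ g′ → conv f g ≗ conv f′ g′
conv-cong f≗f′ g≗g′ zero    = cong₂ ℤ._*_ (f≗f′ 0) (g≗g′ 0)
conv-cong f≗f′ g≗g′ (suc k) =
  cong₂ ℤ._+_ (cong₂ ℤ._*_ (f≗f′ 0) (g≗g′ (suc k))) (conv-cong (f≗f′ ∘ suc) g≗g′ k)

conv-zeroˡ : {f : ℕ → ℤ} (g : ℕ → ℤ) → f ≗ (λ _ → ℤ.0ℤ) → conv f g ≗ (λ _ → ℤ.0ℤ)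
conv-zeroˡ g f≗0 zero    = trans (cong (ℤ._* g 0) (f≗0 0)) (ℤₚ.*-zeroˡ (g 0))
conv-zeroˡ g f≗0 (suc k) = cong₂ ℤ._+_ (trans (cong (ℤ._* g (suc k)) (f≗0 0)) (ℤₚ.*-zeroˡ (g (suc k))))
                                        (conv-zeroˡ g (f≗0 ∘ suc) k)

conv-distribʳ-+ : (f h g : ℕ → ℤ) → conv (λ i → f i ℤ.+ h i) g ≗ (λ k → conv f g k ℤ.+ conv h g k)
conv-distribʳ-+ f h g zero    = ℤₚ.*-distribʳ-+ (g 0) (f 0) (h 0)
conv-distribʳ-+ f h g (suc k) = begin
  (f 0 ℤ.+ h 0) ℤ.* g (suc k) ℤ.+ conv (λ i → f (suc i) ℤ.+ h (suc i)) g k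
    ≡⟨ cong ((f 0 ℤ.+ h 0) ℤ.* g (suc k) ℤ.+_) (conv-distribʳ-+ (f ∘ suc) (h ∘ suc) g k) ⟩
  (f 0 ℤ.+ h 0) ℤ.* g (suc k) ℤ.+ (conv (f ∘ suc) g k ℤ.+ conv (h ∘ suc) g k)
    ≡⟨ rearrange (f 0) (h 0) (g (suc k)) (conv (f ∘ suc) g k) (conv (h ∘ suc) g k) ⟩
  (f 0 ℤ.* g (suc k) ℤ.+ conv (f ∘ suc) g k) ℤ.+ (h 0 ℤ.* g (suc k) ℤ.+ conv (h ∘ suc) g k) ∎
  where
  open ≡-Reasoning
  rearrange : ∀ a b c x y → (a ℤ.+ b) ℤ.* c ℤ.+ (x ℤ.+ y) ≡ (a ℤ.* c ℤ.+ x) ℤ.+ (b ℤ.* c ℤ.+ y)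
  rearrange = solve-∀

conv-negˡ : (f g : ℕ → ℤ) → conv (λ i → - f i) g ≗ (λ k → - conv f g k)
conv-negˡ f g zero    = sym (ℤₚ.neg-distribˡ-* (f 0) (g 0))
conv-negˡ f g (suc k) =
  trans (cong₂ ℤ._+_ (sym (ℤₚ.neg-distribˡ-* (f 0) (g (suc k)))) (conv-negˡ (f ∘ suc) g k))
        (sym (ℤₚ.neg-distrib-+ (f 0 ℤ.* g (suc k)) _))

-- If f lists the coefficients of p(q), then atNegQ f lists those of p(-q).
atNegQ : (ℕ → ℤ) → ℕ → ℤ
atNegQ f i = signPow i ℤ.* f i

atNegQ-suc : (f : ℕ → ℤ) → atNegQ f ∘ suc ≗ atNegQ (λ i → - f (suc i))
atNegQ-suc f i = trans (sym (ℤₚ.neg-distribˡ-* (signPow i) (f (suc i)))) (ℤₚ.neg-distribʳ-* (signPow i) (f (suc i)))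

conv-atNegQ : (f g : ℕ → ℤ) → conv (atNegQ f) (atNegQ g) ≗ atNegQ (conv f g)
conv-atNegQ f g zero    = unit (f 0) (g 0)
  where
  unit : ∀ a b → pos 1 ℤ.* a ℤ.* (pos 1 ℤ.* b) ≡ pos 1 ℤ.* (a ℤ.* b)
  unit = solve-∀
conv-atNegQ f g (suc k) = begin
  pos 1 ℤ.* f 0 ℤ.* (- signPow k ℤ.* g (suc k)) ℤ.+ conv (atNegQ f ∘ suc) (atNegQ g) k
    ≡⟨ cong (pos 1 ℤ.* f 0 ℤ.* (- signPow k ℤ.* g (suc k)) ℤ.+_) (begin
         conv (atNegQ f ∘ suc) (atNegQ g) k                   ≡⟨ conv-cong (atNegQ-suc f) (λ _ → refl) k ⟩
         conv (atNegQ (λ i → - f (suc i))) (atNegQ g) k       ≡⟨ conv-atNegQ (λ i → - f (suc i)) g k ⟩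
         signPow k ℤ.* conv (λ i → - f (suc i)) g k           ≡⟨ cong (signPow k ℤ.*_) (conv-negˡ (f ∘ suc) g k) ⟩
         signPow k ℤ.* - conv (f ∘ suc) g k                   ∎) ⟩
  pos 1 ℤ.* f 0 ℤ.* (- signPow k ℤ.* g (suc k)) ℤ.+ signPow k ℤ.* - conv (f ∘ suc) g k
    ≡⟨ rearrange (signPow k) (f 0) (g (suc k)) (conv (f ∘ suc) g k) ⟩
  - signPow k ℤ.* (f 0 ℤ.* g (suc k) ℤ.+ conv (f ∘ suc) g k) ∎
  where
  open ≡-Reasoning
  rearrange : ∀ s a b c → pos 1 ℤ.* a ℤ.* (- s ℤ.* b) ℤ.+ s ℤ.* - c ≡ - s ℤ.* (a ℤ.* b ℤ.+ c)
  rearrange = solve-∀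

multiplicity : ℕ → List ℕ → ℕ
multiplicity k E = length (filter (_≟ k) E)

multiplicity-↭ : (k : ℕ) {E F : List ℕ} → E ↭ F → multiplicity k E ≡ multiplicity k F
multiplicity-↭ k p = ↭-length (filter-↭ (_≟ k) p)

multiplicity-++ : (k : ℕ) (E F : List ℕ) → multiplicity k (E ++ F) ≡ multiplicity k E + multiplicity k F
multiplicity-++ k E F = trans (cong length (List.filter-++ (_≟ k) E F)) (List.length-++ (filter (_≟ k) E))

multiplicity-zero-map-suc : (E : List ℕ) → multiplicity 0 (map suc E) ≡ 0
multiplicity-zero-map-suc []      = refl
multiplicity-zero-map-suc (e ∷ E) = multiplicity-zero-map-suc E

multiplicity-suc-map-suc : (k : ℕ) (E : List ℕ) → multiplicity (suc k) (map suc E) ≡ multiplicity k E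
multiplicity-suc-map-suc k []      = refl
multiplicity-suc-map-suc k (e ∷ E) with e ℕ.≡ᵇ k
... | true  = cong suc (multiplicity-suc-map-suc k E)
... | false = multiplicity-suc-map-suc k E

gfCoeff : List ℕ → ℕ → ℤ
gfCoeff E k = pos (multiplicity k E)

gfCoeff-map-suc : (E : List ℕ) → gfCoeff (map suc E) ∘ suc ≗ gfCoeff E
gfCoeff-map-suc E k = cong pos (multiplicity-suc-map-suc k E)

gfCoeff-map-+ : (e : ℕ) (F : List ℕ) → gfCoeff (map (e +_) F) ≗ conv (gfCoeff [ e ]) (gfCoeff F)
gfCoeff-map-+ zero    F zero    = trans (cong (λ E → gfCoeff E 0) (List.map-id F)) (sym (ℤₚ.*-identityˡ _))
gfCoeff-map-+ zero    F (suc k) =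
  trans (cong (λ E → gfCoeff E (suc k)) (List.map-id F))
        (sym (trans (cong₂ ℤ._+_ (ℤₚ.*-identityˡ (gfCoeff F (suc k))) (conv-zeroˡ (gfCoeff F) (λ _ → refl) k))
                    (ℤₚ.+-identityʳ (gfCoeff F (suc k)))))
gfCoeff-map-+ (suc e) F zero    =
  trans (cong pos (trans (cong (multiplicity 0) (List.map-∘ F)) (multiplicity-zero-map-suc (map (e +_) F))))
        (sym (ℤₚ.*-zeroˡ (gfCoeff F 0)))
gfCoeff-map-+ (suc e) F (suc k) = begin
  gfCoeff (map (suc ∘ (e +_)) F) (suc k)
    ≡⟨ trans (cong (λ E → gfCoeff E (suc k)) (List.map-∘ F)) (gfCoeff-map-suc (map (e +_) F) k) ⟩
  gfCoeff (map (e +_) F) k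
    ≡⟨ gfCoeff-map-+ e F k ⟩
  conv (gfCoeff [ e ]) (gfCoeff F) k
    ≡⟨ ℤₚ.+-identityˡ _ ⟨
  pos 0 ℤ.+ conv (gfCoeff [ e ]) (gfCoeff F) k
    ≡⟨ cong₂ ℤ._+_ (ℤₚ.*-zeroˡ (gfCoeff F (suc k))) (conv-cong (gfCoeff-map-suc [ e ]) (λ _ → refl) k) ⟨
  pos 0 ℤ.* gfCoeff F (suc k) ℤ.+ conv (gfCoeff [ suc e ] ∘ suc) (gfCoeff F) k ∎
  where open ≡-Reasoning

gfCoeff-⊞ : (E F : List ℕ) → gfCoeff (E ⊞ F) ≗ conv (gfCoeff E) (gfCoeff F)
gfCoeff-⊞ []      F k = sym (conv-zeroˡ (gfCoeff F) (λ _ → refl) k)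
gfCoeff-⊞ (e ∷ E) F k = begin
  gfCoeff (map (e +_) F ++ E ⊞ F) k
    ≡⟨ cong pos (multiplicity-++ k (map (e +_) F) (E ⊞ F)) ⟩
  gfCoeff (map (e +_) F) k ℤ.+ gfCoeff (E ⊞ F) k
    ≡⟨ cong₂ ℤ._+_ (gfCoeff-map-+ e F k) (gfCoeff-⊞ E F k) ⟩
  conv (gfCoeff [ e ]) (gfCoeff F) k ℤ.+ conv (gfCoeff E) (gfCoeff F) k
    ≡⟨ conv-distribʳ-+ (gfCoeff [ e ]) (gfCoeff E) (gfCoeff F) k ⟨
  conv (λ i → gfCoeff [ e ] i ℤ.+ gfCoeff E i) (gfCoeff F) k
    ≡⟨ conv-cong (λ i → cong pos (multiplicity-++ i [ e ] E)) (λ _ → refl) k ⟨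
  conv (gfCoeff (e ∷ E)) (gfCoeff F) k ∎
  where open ≡-Reasoning

coeff-⊕ : (p r : Poly) → coeff (p ⊕ r) ≗ (λ k → coeff p k ℤ.+ coeff r k)
coeff-⊕ []      r       k       = sym (ℤₚ.+-identityˡ _)
coeff-⊕ (a ∷ p) []      k       = sym (ℤₚ.+-identityʳ _)
coeff-⊕ (a ∷ p) (b ∷ r) zero    = refl
coeff-⊕ (a ∷ p) (b ∷ r) (suc k) = coeff-⊕ p r k

coeff-scale : (c : ℤ) (p : Poly) → coeff (scale c p) ≗ (λ k → c ℤ.* coeff p k)
coeff-scale c []      k       = sym (ℤₚ.*-zeroʳ c)
coeff-scale c (b ∷ p) zero    = refl
coeff-scale c (b ∷ p) (suc k) = coeff-scale c p k

coeff-⊗ : (p r : Poly) → coeff (p ⊗ r) ≗ conv (coeff p) (coeff r)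
coeff-⊗ []      r k       = sym (conv-zeroˡ (coeff r) (λ _ → refl) k)
coeff-⊗ (a ∷ p) r zero    = trans (coeff-⊕ (scale a r) _ 0) (trans (ℤₚ.+-identityʳ _) (coeff-scale a r 0))
coeff-⊗ (a ∷ p) r (suc k) =
  trans (coeff-⊕ (scale a r) _ (suc k)) (cong₂ ℤ._+_ (coeff-scale a r (suc k)) (coeff-⊗ p r k))

coeff-monomial : (w : ℕ → ℤ) (e : ℕ) → coeff (monomial (w e) e) ≗ (λ k → w k ℤ.* gfCoeff [ e ] k)
coeff-monomial w zero    zero    = sym (ℤₚ.*-identityʳ (w 0))
coeff-monomial w zero    (suc k) = sym (ℤₚ.*-zeroʳ (w (suc k)))
coeff-monomial w (suc e) zero    = sym (ℤₚ.*-zeroʳ (w 0))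
coeff-monomial w (suc e) (suc k) =
  trans (coeff-monomial (w ∘ suc) e k) (cong (w (suc k) ℤ.*_) (sym (gfCoeff-map-suc [ e ] k)))

coeff-sumPoly-monomial : (w : ℕ → ℤ) (E : List ℕ) →
                         coeff (sumPoly (map (λ e → monomial (w e) e) E)) ≗ (λ k → w k ℤ.* gfCoeff E k)
coeff-sumPoly-monomial w []      k = sym (ℤₚ.*-zeroʳ (w k))
coeff-sumPoly-monomial w (e ∷ E) k = begin
  coeff (monomial (w e) e ⊕ sumPoly (map (λ e → monomial (w e) e) E)) k
    ≡⟨ coeff-⊕ (monomial (w e) e) _ k ⟩
  coeff (monomial (w e) e) k ℤ.+ coeff (sumPoly (map (λ e → monomial (w e) e) E)) k
    ≡⟨ cong₂ ℤ._+_ (coeff-monomial w e k) (coeff-sumPoly-monomial w E k) ⟩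
  w k ℤ.* gfCoeff [ e ] k ℤ.+ w k ℤ.* gfCoeff E k
    ≡⟨ ℤₚ.*-distribˡ-+ (w k) (gfCoeff [ e ] k) (gfCoeff E k) ⟨
  w k ℤ.* (gfCoeff [ e ] k ℤ.+ gfCoeff E k)
    ≡⟨ cong (λ m → w k ℤ.* pos m) (multiplicity-++ k [ e ] E) ⟨
  w k ℤ.* gfCoeff (e ∷ E) k ∎
  where open ≡-Reasoning

coeff-map-upTo : (w : ℕ → ℤ) (m : ℕ) → coeff (map w (upTo m)) ≗ (λ k → w k ℤ.* gfCoeff (upTo m) k)
coeff-map-upTo w zero    k       = sym (ℤₚ.*-zeroʳ (w k))
coeff-map-upTo w (suc m) zero    = begin
  w 0                                                  ≡⟨ ℤₚ.*-identityʳ (w 0) ⟨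
  w 0 ℤ.* pos (suc 0)                                  ≡⟨ cong (λ n → w 0 ℤ.* pos (suc n)) (multiplicity-zero-map-suc (upTo m)) ⟨
  w 0 ℤ.* gfCoeff (0 ∷ map suc (upTo m)) 0              ≡⟨ cong (λ E → w 0 ℤ.* gfCoeff E 0) (upTo-suc m) ⟨
  w 0 ℤ.* gfCoeff (upTo (suc m)) 0                     ∎
  where open ≡-Reasoning
coeff-map-upTo w (suc m) (suc k) = begin
  coeff (map w (upTo (suc m))) (suc k)                  ≡⟨ cong (λ U → coeff (map w U) (suc k)) (upTo-suc m) ⟩
  coeff (map w (map suc (upTo m))) k                    ≡⟨ cong (λ p → coeff p k) (List.map-∘ (upTo m)) ⟨
  coeff (map (w ∘ suc) (upTo m)) k                      ≡⟨ coeff-map-upTo (w ∘ suc) m k ⟩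
  w (suc k) ℤ.* gfCoeff (upTo m) k                      ≡⟨ cong (w (suc k) ℤ.*_) (gfCoeff-map-suc (upTo m) k) ⟨
  w (suc k) ℤ.* gfCoeff (0 ∷ map suc (upTo m)) (suc k)  ≡⟨ cong (λ E → w (suc k) ℤ.* gfCoeff E (suc k)) (upTo-suc m) ⟨
  w (suc k) ℤ.* gfCoeff (upTo (suc m)) (suc k)          ∎
  where open ≡-Reasoning

coeff-prodPoly-qIntNeg : (ss : List ℕ) → coeff (prodPoly (map qIntNeg ss)) ≗ atNegQ (gfCoeff (sumset ss))
coeff-prodPoly-qIntNeg []       zero    = refl
coeff-prodPoly-qIntNeg []       (suc k) = sym (ℤₚ.*-zeroʳ (signPow (suc k)))
coeff-prodPoly-qIntNeg (s ∷ ss) k = begin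
  coeff (qIntNeg s ⊗ prodPoly (map qIntNeg ss)) k
    ≡⟨ coeff-⊗ (qIntNeg s) _ k ⟩
  conv (coeff (qIntNeg s)) (coeff (prodPoly (map qIntNeg ss))) k
    ≡⟨ conv-cong (coeff-map-upTo signPow s) (coeff-prodPoly-qIntNeg ss) k ⟩
  conv (atNegQ (gfCoeff (upTo s))) (atNegQ (gfCoeff (sumset ss))) k
    ≡⟨ conv-atNegQ (gfCoeff (upTo s)) (gfCoeff (sumset ss)) k ⟩
  atNegQ (conv (gfCoeff (upTo s)) (gfCoeff (sumset ss))) k
    ≡⟨ cong (signPow k ℤ.*_) (gfCoeff-⊞ (upTo s) (sumset ss) k) ⟨
  atNegQ (gfCoeff (sumset (s ∷ ss))) k ∎
  where open ≡-Reasoning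

-- Ranks

punchIn : ℕ → ℕ → ℕ
punchIn zero    v       = suc v
punchIn (suc r) zero    = zero
punchIn (suc r) (suc v) = suc (punchIn r v)

punchIn-≤ : {r v : ℕ} → r ≤ v → punchIn r v ≡ suc v
punchIn-≤ {zero}              _       = refl
punchIn-≤ {suc r} {suc v} (s≤s r≤v) = cong suc (punchIn-≤ r≤v)

punchIn-> : {r v : ℕ} → v < r → punchIn r v ≡ v
punchIn-> {suc r} {zero}  _         = refl
punchIn-> {suc r} {suc v} (s≤s v<r) = cong suc (punchIn-> v<r)

punchIn-↭ : {r m : ℕ} → r ≤ m → r ∷ map (punchIn r) (upTo m) ↭ upTo (suc m)
punchIn-↭ {zero}  {m}     _ = ↭-reflexive (trans (cong (0 ∷_) (List.map-cong (λ _ → refl) (upTo m))) (sym (upTo-suc m)))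
punchIn-↭ {suc r} {suc m} (s≤s r≤m) = begin
  suc r ∷ map (punchIn (suc r)) (upTo (suc m))        ≡⟨ cong (λ U → suc r ∷ map (punchIn (suc r)) U) (upTo-suc m) ⟩
  suc r ∷ 0 ∷ map (punchIn (suc r)) (map suc (upTo m)) ≡⟨ cong (λ U → suc r ∷ 0 ∷ U) (trans (sym (List.map-∘ (upTo m))) (List.map-∘ (upTo m))) ⟩
  suc r ∷ 0 ∷ map suc (map (punchIn r) (upTo m))       ↭⟨ ↭.swap (suc r) 0 ↭-refl ⟩
  0 ∷ map suc (r ∷ map (punchIn r) (upTo m))           ↭⟨ ↭-prep 0 (map⁺ suc (punchIn-↭ r≤m)) ⟩
  0 ∷ map suc (upTo (suc m))                           ≡⟨ upTo-suc (suc m) ⟨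
  upTo (suc (suc m))                                   ∎
  where open PermutationReasoning

module Ranks {X : Set} (key : X → ℕ) where

  above? : (y : X) → Decidable (λ x → key y < key x)
  above? y x = key y <? key x

  rank : List X → X → ℕ
  rank xs y = length (filter (above? y) xs)

  DistinctKeys : List X → Set
  DistinctKeys = AllPairs (λ x y → key x ≢ key y)

  rank-↭ : {xs ys : List X} (y : X) → xs ↭ ys → rank xs y ≡ rank ys y
  rank-↭ y p = ↭-length (filter-↭ (above? y) p)

  rank-antitone : (xs : List X) {x y : X} → key y ≤ key x → rank xs x ≤ rank xs y
  rank-antitone xs {x} {y} y≤x = length-filter-⊆ (above? x) (above? y) (ℕ.≤-<-trans y≤x) xs

  rank-< : {xs : List X} {x y : X} → y ∈ xs → key x < key y → rank xs y < rank xs x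
  rank-< {x = x} {y} y∈xs x<y = length-filter-⊂ (above? y) (above? x) (ℕ.<-trans x<y) y∈xs x<y (ℕ.<-irrefl refl)

  rank-∷-self : (x : X) (xs : List X) → rank (x ∷ xs) x ≡ rank xs x
  rank-∷-self x xs = cong length (List.filter-reject (above? x) (ℕ.<-irrefl refl))

  rank-∷ : (x : X) (xs : List X) {y : X} → y ∈ xs → key x ≢ key y →
           rank (x ∷ xs) y ≡ punchIn (rank xs x) (rank xs y)
  rank-∷ x xs {y} y∈xs x≢y with ℕ.<-cmp (key y) (key x)
  ... | tri< y<x _ _ = trans (cong length (List.filter-accept (above? y) y<x))
                             (sym (punchIn-≤ (rank-antitone xs (ℕ.<⇒≤ y<x))))
  ... | tri≈ _ y≡x _ = contradiction (sym y≡x) x≢y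
  ... | tri> _ _ x<y = trans (cong length (List.filter-reject (above? y) (ℕ.<⇒≯ x<y)))
                             (sym (punchIn-> (rank-< y∈xs x<y)))

  ranks-↭ : (xs : List X) → DistinctKeys xs → map (rank xs) xs ↭ upTo (length xs)
  ranks-↭ []       []      = ↭-refl
  ranks-↭ (x ∷ xs) (h ∷ d) = begin
    rank (x ∷ xs) x ∷ map (rank (x ∷ xs)) xs
      ≡⟨ cong₂ _∷_ (rank-∷-self x xs)
                   (trans (List.map-cong-local (All.tabulate (λ y∈xs → rank-∷ x xs y∈xs (All.lookup h y∈xs))))
                          (List.map-∘ xs)) ⟩
    rank xs x ∷ map (punchIn (rank xs x)) (map (rank xs) xs)   ↭⟨ ↭-prep _ (map⁺ _ (ranks-↭ xs d)) ⟩
    rank xs x ∷ map (punchIn (rank xs x)) (upTo (length xs))   ↭⟨ punchIn-↭ (List.length-filter _ xs) ⟩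
    upTo (suc (length xs))                                     ∎
    where open PermutationReasoning

  ∈-above⁻ : (z : X) (xs : List X) {y : X} → y ∈ filter (above? z) xs → key z < key y
  ∈-above⁻ z xs = proj₂ ∘ ∈-filter⁻ (above? z) {xs = xs}

  ∈-notAbove⁻ : (z : X) (xs : List X) {y : X} → y ∈ filter (∁? (above? z)) xs → ¬ key z < key y
  ∈-notAbove⁻ z xs = proj₂ ∘ ∈-filter⁻ (∁? (above? z)) {xs = xs}

  rank-filter-∁ : {p : Level} {P : Pred X p} (P? : Decidable P) (xs : List X) (y : X) →
                  rank xs y ≡ rank (filter P? xs) y + rank (filter (∁? P?) xs) y
  rank-filter-∁ P? xs y = begin
    length (filter (above? y) xs)
      ≡⟨ ↭-length (filter-↭ (above? y) (↭-filter-∁ P? xs)) ⟩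
    length (filter (above? y) (filter P? xs ++ filter (∁? P?) xs))
      ≡⟨ cong length (List.filter-++ (above? y) (filter P? xs) _) ⟩
    length (filter (above? y) (filter P? xs) ++ filter (above? y) (filter (∁? P?) xs))
      ≡⟨ List.length-++ (filter (above? y) (filter P? xs)) ⟩
    rank (filter P? xs) y + rank (filter (∁? P?) xs) y ∎
    where open ≡-Reasoning

  rank-above : (xs : List X) {y z : X} → y ∈ filter (above? z) xs → rank xs y ≡ rank (filter (above? z) xs) y
  rank-above xs {y} {z} y∈U = begin
    rank xs y                      ≡⟨ rank-filter-∁ (above? z) xs y ⟩
    rank U y + rank D y            ≡⟨ cong (λ r → rank U y + length r) (List.filter-none (above? y) (All.tabulate below-y)) ⟩
    rank U y + 0                   ≡⟨ ℕ.+-identityʳ _ ⟩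
    rank U y                       ∎
    where
    open ≡-Reasoning
    U D : List X
    U = filter (above? z) xs
    D = filter (∁? (above? z)) xs
    below-y : ∀ {x} → x ∈ D → ¬ key y < key x
    below-y x∈D y<x = ∈-notAbove⁻ z xs x∈D (ℕ.<-trans (∈-above⁻ z xs y∈U) y<x)

  rank-below : (xs : List X) {y z : X} → y ∈ filter (∁? (above? z)) xs →
               rank xs y ≡ rank xs z + rank (filter (∁? (above? z)) xs) y
  rank-below xs {y} {z} y∈D = begin
    rank xs y                      ≡⟨ rank-filter-∁ (above? z) xs y ⟩
    rank U y + rank D y            ≡⟨ cong (λ r → length r + rank D y) (List.filter-all (above? y) (All.tabulate above-y)) ⟩
    length U + rank D y            ∎
    where
    open ≡-Reasoning
    U D : List X
    U = filter (above? z) xs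
    D = filter (∁? (above? z)) xs
    above-y : ∀ {x} → x ∈ U → key y < key x
    above-y x∈U = ℕ.≤-<-trans (ℕ.≮⇒≥ (∈-notAbove⁻ z xs y∈D)) (∈-above⁻ z xs x∈U)

  -- The elements above z are lifted past all the others, which rotates the ranks cyclically.
  rotatedRanks-↭ : (xs : List X) → DistinctKeys xs → (z : X) →
                   map (λ y → rank xs y + (if key z <ᵇ key y then length xs else 0)) xs
                     ↭ map (rank xs z +_) (upTo (length xs))
  rotatedRanks-↭ xs d z = begin
    map f xs                                          ↭⟨ map⁺ f (↭-filter-∁ (above? z) xs) ⟩
    map f (U ++ D)                                    ≡⟨ List.map-++ f U D ⟩
    map f U ++ map f D                                ≡⟨ cong₂ _++_ (ranks-in U f-above) (ranks-in D f-below) ⟩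
    map (N +_) (map (rank U) U) ++ map (u +_) (map (rank D) D)
      ↭⟨ ++⁺ (map⁺ (N +_) (ranks-↭ U (AllPairs.filter⁺ _ d))) (map⁺ (u +_) (ranks-↭ D (AllPairs.filter⁺ _ d))) ⟩
    map (N +_) (upTo u) ++ map (u +_) (upTo δ)        ↭⟨ ++-comm (map (N +_) (upTo u)) _ ⟩
    map (u +_) (upTo δ) ++ map (N +_) (upTo u)        ≡⟨ cong (λ n → map (u +_) (upTo δ) ++ map (n +_) (upTo u)) N≡u+δ ⟩
    map (u +_) (upTo δ) ++ map ((u + δ) +_) (upTo u)  ≡⟨ map-+-upTo-+ u δ ⟨
    map (u +_) (upTo (u + δ))                         ≡⟨ cong (λ n → map (u +_) (upTo n)) N≡u+δ ⟨
    map (u +_) (upTo N)                               ∎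
    where
    open PermutationReasoning
    f : X → ℕ
    f y = rank xs y + (if key z <ᵇ key y then length xs else 0)
    U D : List X
    U = filter (above? z) xs
    D = filter (∁? (above? z)) xs
    N u δ : ℕ
    N = length xs
    u = length U
    δ = length D
    N≡u+δ : N ≡ u + δ
    N≡u+δ = trans (↭-length (↭-filter-∁ (above? z) xs)) (List.length-++ U)
    ranks-in : (V : List X) {c : ℕ} → (∀ {y} → y ∈ V → f y ≡ c + rank V y) →
               map f V ≡ map (c +_) (map (rank V) V)
    ranks-in V h = trans (List.map-cong-local (All.tabulate h)) (List.map-∘ V)
    f-above : ∀ {y} → y ∈ U → f y ≡ N + rank U y
    f-above {y} y∈U =
      trans (cong (λ b → rank xs y + (if b then N else 0)) (dec-true (key z <? key y) (∈-above⁻ z xs y∈U)))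
            (trans (ℕ.+-comm (rank xs y) N) (cong (N +_) (rank-above xs y∈U)))
    f-below : ∀ {y} → y ∈ D → f y ≡ u + rank D y
    f-below {y} y∈D =
      trans (cong (λ b → rank xs y + (if b then N else 0)) (dec-false (key z <? key y) (∈-notAbove⁻ z xs y∈D)))
            (trans (ℕ.+-identityʳ (rank xs y)) (rank-below xs y∈D))

module _ {A : Set} where

  words-↭ : {X Y : List A} (k : ℕ) → X ↭ Y → words X k ↭ words Y k
  words-↭ zero    p = ↭-refl
  words-↭ {X} {Y} (suc k) p = ↭-trans
    (concatMap-cong-↭ X (λ _ → map⁺ _ (words-↭ k p)))
    (concatMap-↭ (λ x → map (x Vec.∷_) (words Y k)) p)

  words-∷ʳ : (X : List A) (k : ℕ) → words X (suc k) ↭ concatMap (λ z → map (_∷ʳ z) (words X k)) X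
  words-∷ʳ X zero    = ↭-refl
  words-∷ʳ X (suc k) = begin
    concatMap (λ x → map (x Vec.∷_) (words X (suc k))) X
      ↭⟨ concatMap-cong-↭ X (λ _ → map⁺ _ (words-∷ʳ X k)) ⟩
    concatMap (λ x → map (x Vec.∷_) (concatMap (λ z → map (_∷ʳ z) (words X k)) X)) X
      ≡⟨ List.concatMap-cong (λ x → map-concatMap-map (x Vec.∷_) (λ z → _∷ʳ z) X (words X k)) X ⟩
    concatMap (λ x → concatMap (λ z → map (λ u → x Vec.∷ (u ∷ʳ z)) (words X k)) X) X
      ↭⟨ concatMap-comm (λ x z → map (λ u → x Vec.∷ (u ∷ʳ z)) (words X k)) X X ⟩
    concatMap (λ z → concatMap (λ x → map (λ u → x Vec.∷ (u ∷ʳ z)) (words X k)) X) X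
      ≡⟨ List.concatMap-cong (λ z → map-concatMap-map (_∷ʳ z) (λ x → x Vec.∷_) X (words X k)) X ⟨
    concatMap (λ z → map (_∷ʳ z) (words X (suc k))) X ∎
    where open PermutationReasoning

  filter-words : {p : Level} {P : Pred A p} (P? : Decidable P) (X : List A) (k : ℕ) →
                 filter (λ w → all? P? (Vec.toList w)) (words X k) ≡ words (filter P? X) k
  filter-words P? X zero    = refl
  filter-words {P = P} P? X (suc k) = begin
    filter AllP? (concatMap (λ x → map (x Vec.∷_) (words X k)) X)
      ≡⟨ filter-concatMap AllP? _ X ⟩
    concatMap (λ x → filter AllP? (map (x Vec.∷_) (words X k))) X
      ≡⟨ List.concatMap-cong (λ x → trans (filter-map AllP? (x Vec.∷_) (words X k)) (extend x)) X ⟩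
    concatMap (λ x → if does (P? x) then map (x Vec.∷_) (words (filter P? X) k) else []) X
      ≡⟨ concatMap-filter P? (λ x → map (x Vec.∷_) (words (filter P? X) k)) X ⟨
    concatMap (λ x → map (x Vec.∷_) (words (filter P? X) k)) (filter P? X) ∎
    where
    open ≡-Reasoning
    AllP? : {m : ℕ} → Decidable (λ (w : Vec A m) → All P (Vec.toList w))
    AllP? w = all? P? (Vec.toList w)
    extend : (x : A) → map (x Vec.∷_) (filter (AllP? ∘ (x Vec.∷_)) (words X k)) ≡
                       (if does (P? x) then map (x Vec.∷_) (words (filter P? X) k) else [])
    extend x with P? x
    ... | yes px = cong (map (x Vec.∷_))
      (trans (List.filter-≐ _ AllP? ((λ { (_ ∷ all) → all }) , (px ∷_)) (words X k)) (filter-words P? X k))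
    ... | no ¬px = cong (map (x Vec.∷_))
      (List.filter-none _ {xs = words X k} (All.tabulate λ _ → λ { (px ∷ _) → ¬px px }))

-- Signed permutations

module SignedPermutations (n : ℕ) where

  open Ranks (key {n})

  signed : List (Fin n) → List (Letter n)
  signed = concatMap (λ a → (true , a) ∷ (false , a) ∷ [])

  length-signed : (as : List (Fin n)) → length (signed as) ≡ 2 * length as
  length-signed []       = refl
  length-signed (a ∷ as) = trans (cong (suc ∘ suc) (length-signed as)) (sym (ℕ.*-suc 2 (length as)))

  ∈-signed⁻ : {l : Letter n} (as : List (Fin n)) → l ∈ signed as → proj₂ l ∈ as
  ∈-signed⁻ (a ∷ as) (here refl)         = here refl
  ∈-signed⁻ (a ∷ as) (there (here refl)) = here refl
  ∈-signed⁻ (a ∷ as) (there (there l∈))  = there (∈-signed⁻ as l∈)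

  negative<positive : (a b : Fin n) → key (true , a) < key (false , b)
  negative<positive a b = ℕ.<-≤-trans (Fin.toℕ<n a) (ℕ.m≤m+n n (toℕ b))

  key-injective : (l l′ : Letter n) → key l ≡ key l′ → l ≡ l′
  key-injective (true  , a) (true  , b) eq = cong (true ,_) (Fin.toℕ-injective eq)
  key-injective (false , a) (false , b) eq = cong (false ,_) (Fin.toℕ-injective (ℕ.+-cancelˡ-≡ n _ _ eq))
  key-injective (true  , a) (false , b) eq = contradiction eq (ℕ.<⇒≢ (negative<positive a b))
  key-injective (false , a) (true  , b) eq = contradiction (sym eq) (ℕ.<⇒≢ (negative<positive b a))

  signed-distinctKeys : {as : List (Fin n)} → Unique as → DistinctKeys (signed as)
  signed-distinctKeys []                = []
  signed-distinctKeys {a ∷ as} (a∉as ∷ u) =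
    (ℕ.<⇒≢ (negative<positive a a) ∷ fresh true) ∷ fresh false ∷ signed-distinctKeys u
    where
    fresh : (b : Bool) → All (λ l → key (b , a) ≢ key l) (signed as)
    fresh b = All.tabulate λ {l} l∈ eq → All.lookup a∉as (∈-signed⁻ as l∈) (cong proj₂ (key-injective (b , a) l eq))

  letters↭signed : List.cartesianProduct (true ∷ false ∷ []) (List.allFin n) ↭ signed (List.allFin n)
  letters↭signed = ↭-trans (↭-reflexive (cong (map (true ,_) as ++_) (List.++-identityʳ _))) (interleave as)
    where
    as : List (Fin n)
    as = List.allFin n
    interleave : (as : List (Fin n)) → map (true ,_) as ++ map (false ,_) as ↭ signed as
    interleave []       = ↭-refl
    interleave (a ∷ as) = ↭-prep (true , a)
      (↭-trans (shift (false , a) (map (true ,_) as) _) (↭-prep (false , a) (interleave as)))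

  fresh? : (a : Fin n) → Decidable (λ (l : Letter n) → a ≢ proj₂ l)
  fresh? a l = ¬? (a Fin.≟ proj₂ l)

  filter-fresh-signed : {a : Fin n} {as : List (Fin n)} → All (a ≢_) as →
                        filter (fresh? a) (signed (a ∷ as)) ≡ signed as
  filter-fresh-signed {a} {as} a∉as =
    trans (List.filter-reject (fresh? a) {x = true , a} (λ a≢a → a≢a refl))
    (trans (List.filter-reject (fresh? a) {x = false , a} {xs = signed as} (λ a≢a → a≢a refl))
           (List.filter-all (fresh? a) (All.tabulate λ l∈ → All.lookup a∉as (∈-signed⁻ as l∈))))

  rank-signed-∷ : (z : Letter n) (as : List (Fin n)) →
                  rank (signed (proj₂ z ∷ as)) z ≡ neg Vec.[ z ] + rank (signed as) z
  rank-signed-∷ z@(true , a) as = cong length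
    (trans (List.filter-reject (above? z) {x = true , a} (ℕ.<-irrefl refl))
           (List.filter-accept (above? z) {x = false , a} {xs = signed as} (negative<positive a a)))
  rank-signed-∷ z@(false , a) as = cong length
    (trans (List.filter-reject (above? z) {x = true , a} (ℕ.<⇒≯ (negative<positive a a)))
           (List.filter-reject (above? z) {x = false , a} {xs = signed as} (ℕ.<-irrefl refl)))

  neg-∷ʳ : {k : ℕ} (u : Vec (Letter n) k) (z : Letter n) → neg (u ∷ʳ z) ≡ neg u + neg Vec.[ z ]
  neg-∷ʳ Vec.[]              (true  , _) = refl
  neg-∷ʳ Vec.[]              (false , _) = refl
  neg-∷ʳ ((true  , _) Vec.∷ u) z = cong suc (neg-∷ʳ u z)
  neg-∷ʳ ((false , _) Vec.∷ u) z = neg-∷ʳ u z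

  descentAt : ℕ → Letter n → Letter n → ℕ
  descentAt i y z = if key z <ᵇ key y then i else 0

  majFrom-∷ʳ : {j : ℕ} (i : ℕ) (u : Vec (Letter n) (suc j)) (z : Letter n) →
               majFrom i (u ∷ʳ z) ≡ majFrom i u + descentAt (i + j) (Vec.last u) z
  majFrom-∷ʳ {zero}  i (x Vec.∷ Vec.[]) z =
    trans (ℕ.+-identityʳ (descentAt i x z)) (cong (λ m → descentAt m x z) (sym (ℕ.+-identityʳ i)))
  majFrom-∷ʳ {suc j} i (x Vec.∷ y Vec.∷ w) z = begin
    d₁ + majFrom (suc i) ((y Vec.∷ w) ∷ʳ z)  ≡⟨ cong (d₁ +_) (majFrom-∷ʳ (suc i) (y Vec.∷ w) z) ⟩
    d₁ + (m + descentAt (suc i + j) l z)      ≡⟨ ℕ.+-assoc d₁ m _ ⟨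
    d₁ + m + descentAt (suc i + j) l z        ≡⟨ cong (λ s → d₁ + m + descentAt s l z) (sym (ℕ.+-suc i j)) ⟩
    d₁ + m + descentAt (i + suc j) l z        ∎
    where
    open ≡-Reasoning
    d₁ m : ℕ
    d₁ = descentAt i x y
    m  = majFrom (suc i) (y Vec.∷ w)
    l : Letter n
    l = Vec.last (y Vec.∷ w)

  fmajIncrement : ℕ → Letter n → Letter n → ℕ
  fmajIncrement k y z = descentAt (2 * k) y z + neg Vec.[ z ]

  fmaj-∷ʳ : {j : ℕ} (u : Vec (Letter n) (suc j)) (z : Letter n) →
            fmaj (u ∷ʳ z) ≡ fmaj u + fmajIncrement (suc j) (Vec.last u) z
  fmaj-∷ʳ {j} u z = begin
    2 * maj (u ∷ʳ z) + neg (u ∷ʳ z)          ≡⟨ cong₂ (λ m ν → 2 * m + ν) (majFrom-∷ʳ 1 u z) (neg-∷ʳ u z) ⟩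
    2 * (maj u + d) + (neg u + neg Vec.[ z ]) ≡⟨ rearrange (maj u) d (neg u) (neg Vec.[ z ]) ⟩
    fmaj u + (2 * d + neg Vec.[ z ])          ≡⟨ cong (λ m → fmaj u + (m + neg Vec.[ z ])) (double-descentAt (Vec.last u)) ⟩
    fmaj u + fmajIncrement (suc j) (Vec.last u) z ∎
    where
    open ≡-Reasoning
    d : ℕ
    d = descentAt (suc j) (Vec.last u) z
    rearrange : ∀ m d ν ε → 2 * (m + d) + (ν + ε) ≡ 2 * m + ν + (2 * d + ε)
    rearrange = ℕ-Solver.solve-∀
    double-descentAt : ∀ y → 2 * descentAt (suc j) y z ≡ descentAt (2 * suc j) y z
    double-descentAt y with key z <ᵇ key y
    ... | true  = refl
    ... | false = refl

  injective? : {k : ℕ} → Decidable (λ (w : Vec (Letter n) k) → Unique (absVals w))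
  injective? w = UF.unique? n (absVals w)

  injectiveWords : List (Letter n) → (k : ℕ) → List (Vec (Letter n) k)
  injectiveWords X k = filter injective? (words X k)

  injectiveWords-↭ : {X Y : List (Letter n)} (k : ℕ) → X ↭ Y → injectiveWords X k ↭ injectiveWords Y k
  injectiveWords-↭ k p = filter-↭ injective? (words-↭ k p)

  absVals-∷ʳ : {k : ℕ} (w : Vec (Letter n) k) (z : Letter n) → absVals (w ∷ʳ z) ≡ absVals w ++ [ proj₂ z ]
  absVals-∷ʳ w z = trans (cong (map proj₂) (Vecₚ.toList-∷ʳ z w)) (List.map-++ proj₂ (Vec.toList w) _)

  injective-∷ʳ : {k : ℕ} (z : Letter n) →
    (λ (w : Vec (Letter n) k) → Unique (absVals (w ∷ʳ z))) ≐
    (λ w → All (λ l → proj₂ z ≢ proj₂ l) (Vec.toList w) × Unique (absVals w))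
  injective-∷ʳ {k} z = to , from
    where
    to : {w : Vec (Letter n) k} → Unique (absVals (w ∷ʳ z)) →
         All (λ l → proj₂ z ≢ proj₂ l) (Vec.toList w) × Unique (absVals w)
    to {w} u with Unique-∷ʳ⁻ (absVals w) (subst Unique (absVals-∷ʳ w z) u)
    ... | u′ , z∉w = Allₚ.map⁻ z∉w , u′
    from : {w : Vec (Letter n) k} → All (λ l → proj₂ z ≢ proj₂ l) (Vec.toList w) × Unique (absVals w) →
           Unique (absVals (w ∷ʳ z))
    from {w} (z∉w , u′) = subst Unique (sym (absVals-∷ʳ w z)) (Unique-∷ʳ⁺ u′ (Allₚ.map⁺ z∉w))

  injectiveWords-∷ʳ : (X : List (Letter n)) (k : ℕ) (z : Letter n) →
    filter injective? (map (_∷ʳ z) (words X k)) ≡ map (_∷ʳ z) (injectiveWords (filter (fresh? (proj₂ z)) X) k)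
  injectiveWords-∷ʳ X k z = begin
    filter injective? (map (_∷ʳ z) (words X k))
      ≡⟨ filter-map injective? (_∷ʳ z) (words X k) ⟩
    map (_∷ʳ z) (filter (injective? ∘ (_∷ʳ z)) (words X k))
      ≡⟨ cong (map (_∷ʳ z)) (List.filter-≐ _ (fresh-all? ∩? injective?) (injective-∷ʳ z) (words X k)) ⟩
    map (_∷ʳ z) (filter (fresh-all? ∩? injective?) (words X k))
      ≡⟨ cong (map (_∷ʳ z)) (filter-∩ fresh-all? injective? (words X k)) ⟩
    map (_∷ʳ z) (filter injective? (filter fresh-all? (words X k)))
      ≡⟨ cong (λ W → map (_∷ʳ z) (filter injective? W)) (filter-words (fresh? (proj₂ z)) X k) ⟩
    map (_∷ʳ z) (injectiveWords (filter (fresh? (proj₂ z)) X) k) ∎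
    where
    open ≡-Reasoning
    fresh-all? : Decidable (λ (w : Vec (Letter n) k) → All (λ l → proj₂ z ≢ proj₂ l) (Vec.toList w))
    fresh-all? w = all? (fresh? (proj₂ z)) (Vec.toList w)

  rankShifted : List (Letter n) → List ℕ → List (ℕ × Letter n)
  rankShifted X T = concatMap (λ z → map (λ t → rank X z + t , z) T) X

  map-append-rankShifted : (Y : List (Letter n)) (T : List ℕ) (δ : Letter n → ℕ) (z : Letter n) →
    map (λ (e , y) → e + δ y , z) (rankShifted Y T) ≡ map (_, z) (map (λ y → rank Y y + δ y) Y ⊞ T)
  map-append-rankShifted Y T δ z = begin
    map (λ (e , y) → e + δ y , z) (rankShifted Y T)
      ≡⟨ map-concatMap-map _ (λ y t → rank Y y + t , y) Y T ⟩
    concatMap (λ y → map (λ t → rank Y y + t + δ y , z) T) Y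
      ≡⟨ List.concatMap-cong (λ y → List.map-cong (λ t → cong (_, z) (+-right-comm (rank Y y) t (δ y))) T) Y ⟩
    concatMap (λ y → map (λ t → rank Y y + δ y + t , z) T) Y
      ≡⟨ map-concatMap-map (_, z) (λ y t → rank Y y + δ y + t) Y T ⟨
    map (_, z) (concatMap (λ y → map ((rank Y y + δ y) +_) T) Y)
      ≡⟨ cong (map (_, z)) (List.concatMap-map (λ e → map (e +_) T) (λ y → rank Y y + δ y) Y) ⟨
    map (_, z) (map (λ y → rank Y y + δ y) Y ⊞ T) ∎
    where open ≡-Reasoning

  descentRanks-↭ : {j : ℕ} {as as′ : List (Fin n)} {z : Letter n} →
    as ↭ proj₂ z ∷ as′ → Unique as′ → length as′ ≡ suc j →
    map (λ y → rank (signed as′) y + fmajIncrement (suc j) y z) (signed as′)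
      ↭ map (rank (signed as) z +_) (upTo (2 * suc j))
  descentRanks-↭ {j} {as} {as′} {z} as↭ u len = begin
    map (λ y → rank X′ y + fmajIncrement (suc j) y z) X′
      ≡⟨ List.map-cong (λ y → sym (ℕ.+-assoc (rank X′ y) _ _)) X′ ⟩
    map (λ y → rank X′ y + descentAt (2 * suc j) y z + ε) X′
      ≡⟨ trans (List.map-cong (λ y → cong (λ N → rank X′ y + descentAt N y z + ε) (sym |X′|)) X′) (List.map-∘ X′) ⟩
    map (_+ ε) (map (λ y → rank X′ y + descentAt (length X′) y z) X′)
      ↭⟨ map⁺ (_+ ε) (rotatedRanks-↭ X′ (signed-distinctKeys u) z) ⟩
    map (_+ ε) (map (rank X′ z +_) (upTo (length X′)))
      ≡⟨ trans (sym (List.map-∘ (upTo (length X′)))) (cong (λ N → map (λ t → rank X′ z + t + ε) (upTo N)) |X′|) ⟩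
    map (λ t → rank X′ z + t + ε) (upTo (2 * suc j))
      ≡⟨ List.map-cong (λ t → trans (+-right-comm (rank X′ z) t ε) (cong (_+ t) rank-z)) (upTo (2 * suc j)) ⟩
    map (rank (signed as) z +_) (upTo (2 * suc j)) ∎
    where
    open PermutationReasoning
    X′ : List (Letter n)
    X′ = signed as′
    ε : ℕ
    ε = neg Vec.[ z ]
    |X′| : length X′ ≡ 2 * suc j
    |X′| = trans (length-signed as′) (cong (2 *_) len)
    rank-z : rank X′ z + ε ≡ rank (signed as) z
    rank-z = trans (ℕ.+-comm (rank X′ z) ε)
                   (sym (trans (rank-↭ z (concatMap-↭ _ as↭)) (rank-signed-∷ z as′)))

  fmajLast : {k : ℕ} → Vec (Letter n) (suc k) → ℕ × Letter n
  fmajLast w = fmaj w , Vec.last w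

  fmajLast-∷ʳ-↭ : {j : ℕ} {as as′ : List (Fin n)} {z : Letter n} →
    as ↭ proj₂ z ∷ as′ → Unique as′ → All (proj₂ z ≢_) as′ → length as′ ≡ suc j →
    map fmajLast (injectiveWords (signed as′) (suc j)) ↭ rankShifted (signed as′) (evenSumset j) →
    map fmajLast (filter injective? (map (_∷ʳ z) (words (signed as) (suc j))))
      ↭ map (λ t → rank (signed as) z + t , z) (evenSumset (suc j))
  fmajLast-∷ʳ-↭ {j} {as} {as′} {z} as↭ u z∉as′ len ih = begin
    map fmajLast (filter injective? (map (_∷ʳ z) (words (signed as) (suc j))))
      ≡⟨ cong (map fmajLast) (injectiveWords-∷ʳ (signed as) (suc j) z) ⟩
    map fmajLast (map (_∷ʳ z) (injectiveWords (filter (fresh? (proj₂ z)) (signed as)) (suc j)))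
      ↭⟨ map⁺ _ (map⁺ _ (injectiveWords-↭ (suc j) letters↭)) ⟩
    map fmajLast (map (_∷ʳ z) (injectiveWords X′ (suc j)))
      ≡⟨ trans (sym (List.map-∘ W′)) (trans (List.map-cong fmajLast-append W′) (List.map-∘ W′)) ⟩
    map append (map fmajLast (injectiveWords X′ (suc j)))
      ↭⟨ map⁺ append ih ⟩
    map append (rankShifted X′ (evenSumset j))
      ≡⟨ map-append-rankShifted X′ (evenSumset j) (λ y → fmajIncrement (suc j) y z) z ⟩
    map (_, z) (map (λ y → rank X′ y + fmajIncrement (suc j) y z) X′ ⊞ evenSumset j)
      ↭⟨ map⁺ (_, z) (⊞-congˡ (evenSumset j) (descentRanks-↭ {z = z} as↭ u len)) ⟩
    map (_, z) (map (rank (signed as) z +_) (upTo (2 * suc j)) ⊞ evenSumset j)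
      ≡⟨ map-tag-⊞ (rank (signed as) z) z (upTo (2 * suc j)) (evenSumset j) ⟩
    map (λ t → rank (signed as) z + t , z) (evenSumset (suc j)) ∎
    where
    open PermutationReasoning
    X′ : List (Letter n)
    X′ = signed as′
    W′ : List (Vec (Letter n) (suc j))
    W′ = injectiveWords X′ (suc j)
    letters↭ : filter (fresh? (proj₂ z)) (signed as) ↭ X′
    letters↭ = ↭-trans (filter-↭ (fresh? (proj₂ z)) (concatMap-↭ _ as↭))
                       (↭-reflexive (filter-fresh-signed z∉as′))
    append : ℕ × Letter n → ℕ × Letter n
    append (e , y) = e + fmajIncrement (suc j) y z , z
    fmajLast-append : (w : Vec (Letter n) (suc j)) → fmajLast (w ∷ʳ z) ≡ append (fmajLast w)
    fmajLast-append w = cong₂ _,_ (fmaj-∷ʳ w z) (Vecₚ.last-∷ʳ z w)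

  fmajLast-↭ : (j : ℕ) (as : List (Fin n)) → Unique as → length as ≡ suc j →
    map fmajLast (injectiveWords (signed as) (suc j)) ↭ rankShifted (signed as) (evenSumset j)
  fmajLast-↭ zero (a ∷ []) _ refl =
    ↭-reflexive (cong₂ _∷_ (oneLetter (true , a)) (cong₂ _∷_ (oneLetter (false , a)) refl))
    where
    oneLetter : (z : Letter n) → fmajLast Vec.[ z ] ≡ (rank (signed [ proj₂ z ]) z + 0 , z)
    oneLetter z = cong (_, z) (sym (trans (ℕ.+-identityʳ _) (trans (rank-signed-∷ z []) (ℕ.+-identityʳ _))))
  fmajLast-↭ (suc j) as u len = begin
    map fmajLast (filter injective? (words X (suc (suc j))))
      ↭⟨ map⁺ fmajLast (filter-↭ injective? (words-∷ʳ X (suc j))) ⟩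
    map fmajLast (filter injective? (concatMap (λ z → map (_∷ʳ z) (words X (suc j))) X))
      ≡⟨ trans (cong (map fmajLast) (filter-concatMap injective? _ X)) (List.map-concatMap fmajLast _ X) ⟩
    concatMap (λ z → map fmajLast (filter injective? (map (_∷ʳ z) (words X (suc j))))) X
      ↭⟨ concatMap-cong-↭ X lastLetter ⟩
    rankShifted X (evenSumset (suc j)) ∎
    where
    open PermutationReasoning
    X : List (Letter n)
    X = signed as
    lastLetter : ∀ {z} → z ∈ X → map fmajLast (filter injective? (map (_∷ʳ z) (words X (suc j))))
                                   ↭ map (λ t → rank X z + t , z) (evenSumset (suc j))
    lastLetter z∈X with Unique-remove u (∈-signed⁻ as z∈X)
    ... | as′ , as↭ , u′ , z∉as′ =
      fmajLast-∷ʳ-↭ as↭ u′ z∉as′ len′ (fmajLast-↭ j as′ u′ len′)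
      where
      len′ : length as′ ≡ suc j
      len′ = ℕ.suc-injective (trans (sym (↭-length as↭)) len)

  map-proj₁-rankShifted : (X : List (Letter n)) (T : List ℕ) → map proj₁ (rankShifted X T) ≡ map (rank X) X ⊞ T
  map-proj₁-rankShifted X T =
    trans (map-concatMap-map proj₁ (λ z t → rank X z + t , z) X T) (sym (List.concatMap-map _ (rank X) X))

-- The distribution of fmaj and the theorem

fmaj-Bn-↭ : (n : ℕ) → map fmaj (Bn n) ↭ evenSumset n
fmaj-Bn-↭ zero    = ↭-refl
fmaj-Bn-↭ (suc j) = begin
  map fmaj (Bn n)                                 ≡⟨ List.map-∘ (Bn n) ⟩
  map proj₁ (map fmajLast (injectiveWords L n))   ↭⟨ map⁺ proj₁ (map⁺ fmajLast (injectiveWords-↭ n letters↭signed)) ⟩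
  map proj₁ (map fmajLast (injectiveWords X n))   ↭⟨ map⁺ proj₁ (fmajLast-↭ j as (Uniqueₚ.allFin⁺ n) |as|) ⟩
  map proj₁ (rankShifted X (evenSumset j))        ≡⟨ map-proj₁-rankShifted X (evenSumset j) ⟩
  map (rank X) X ⊞ evenSumset j                   ↭⟨ ⊞-congˡ (evenSumset j) (ranks-↭ X (signed-distinctKeys (Uniqueₚ.allFin⁺ n))) ⟩
  upTo (length X) ⊞ evenSumset j                  ≡⟨ cong (λ N → upTo N ⊞ evenSumset j) (trans (length-signed as) (cong (2 *_) |as|)) ⟩
  evenSumset n                                    ∎
  where
  open PermutationReasoning
  n : ℕ
  n = suc j
  open SignedPermutations n
  open Ranks (key {n})
  as : List (Fin n)
  as = List.allFin n
  L X : List (Letter n)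
  L = List.cartesianProduct (true ∷ false ∷ []) as
  X = signed as
  |as| : length as ≡ n
  |as| = List.length-tabulate {n = n} id

signPow-2*+ : (m r : ℕ) → signPow (2 * m + r) ≡ signPow r
signPow-2*+ zero    r = refl
signPow-2*+ (suc m) r = trans (cong (λ e → signPow (e + r)) (ℕ.*-suc 2 m))
                              (trans (ℤₚ.neg-involutive _) (signPow-2*+ m r))

signPow-fmaj : {m k : ℕ} (σ : Vec (Letter m) k) → signPow (fmaj σ) ≡ signPow (neg σ)
signPow-fmaj σ = signPow-2*+ (maj σ) (neg σ)

coeff-lhs : (n : ℕ) → coeff (lhs n) ≗ atNegQ (gfCoeff (map fmaj (Bn n)))
coeff-lhs n k = begin
  coeff (sumPoly (map (λ σ → monomial (signPow (neg σ)) (fmaj σ)) (Bn n))) k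
    ≡⟨ cong (λ p → coeff (sumPoly p) k)
            (List.map-cong (λ σ → cong (λ c → monomial c (fmaj σ)) (sym (signPow-fmaj σ))) (Bn n)) ⟩
  coeff (sumPoly (map (λ σ → monomial (signPow (fmaj σ)) (fmaj σ)) (Bn n))) k
    ≡⟨ cong (λ p → coeff (sumPoly p) k) (List.map-∘ (Bn n)) ⟩
  coeff (sumPoly (map (λ e → monomial (signPow e) e) (map fmaj (Bn n)))) k
    ≡⟨ coeff-sumPoly-monomial signPow (map fmaj (Bn n)) k ⟩
  atNegQ (gfCoeff (map fmaj (Bn n))) k ∎
  where open ≡-Reasoning

coeff-rhs : (n : ℕ) → coeff (rhs n) ≗ atNegQ (gfCoeff (sumset (map (λ i → 2 * suc i) (upTo n))))
coeff-rhs n k = trans (cong (λ p → coeff (prodPoly p) k) (List.map-∘ {g = qIntNeg} (upTo n)))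
                      (coeff-prodPoly-qIntNeg (map (λ i → 2 * suc i) (upTo n)) k)

-- The identity holds for n = 0 as well.
theorem6p1 : (n : ℕ) → n ≥ 1 → (k : ℕ) → coeff (lhs n) k ≡ coeff (rhs n) k
theorem6p1 n _ k = begin
  coeff (lhs n) k                                                ≡⟨ coeff-lhs n k ⟩
  atNegQ (gfCoeff (map fmaj (Bn n))) k                           ≡⟨ cong (λ m → signPow k ℤ.* pos m) (multiplicity-↭ k fmaj↭) ⟩
  atNegQ (gfCoeff (sumset (map (λ i → 2 * suc i) (upTo n)))) k   ≡⟨ coeff-rhs n k ⟨
  coeff (rhs n) k                                                ∎
  where
  open ≡-Reasoning
  fmaj↭ : map fmaj (Bn n) ↭ sumset (map (λ i → 2 * suc i) (upTo n))
  fmaj↭ = ↭-trans (fmaj-Bn-↭ n) (evenSumset-↭ n)
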